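{- Let $D>1$ be a squarefree integer, $K=\mathbb{Q}(\sqrt{D})$, and let $\delta=2\sqrt{D}$ if $D\equiv 2,3\pmod 4$ and $\delta=\sqrt{D}$ if $D\equiv 1\pmod 4$. Let $\alpha\in\mathcal{O}_K$ be totally positive with $N(\alpha)\leq\delta$, and suppose that for every integer $n\geq 2$ we have $n\nmid\alpha$ in $\mathcal{O}_K$ (i.e. $\alpha/n\notin\mathcal{O}_K$). Then $\alpha$ is not a sum of two totally positive elements of $\mathcal{O}_K$.
   Context: $K\subset\mathbb{R}$ with $\sqrt D>0$; $a'$ is the Galois conjugate of $a\in K$, $N(a)=aa'$; $a$ is totally positive if $a>0$ and $a'>0$. -}

module Defs where

open import Data.Nat as ℕ using (ℕ)
open import Data.Nat.DivMod using (_%_)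
open import Data.Integer using (ℤ; +_; _+_; _-_; _*_; -_; _<_; 0ℤ)
open import Data.Integer.Divisibility using (_∣_)
open import Data.Product using (Σ; _×_; ∃)
open import Data.Sum using (_⊎_)
open import Relation.Binary.PropositionalEquality using (_≡_)
open import Relation.Nullary using (¬_)

SquareFree : ℕ → Set
SquareFree D = ∀ m → (m ℕ.* m) Data.Nat.Divisibility.∣ D → m ≡ 1
  where import Data.Nat.Divisibility

-- Elements of K = Q(√D) appearing here are encoded in "doubled" coordinates:
-- the pair (x , y) of integers stands for the real number (x + y √D) / 2.

-- (x + y √D) / 2 > 0 in ℝ (using that √D is irrational, D nonsquare):
Pos : ℕ → ℤ → ℤ → Set
Pos D x y = (0ℤ < x × (+ D) * (y * y) < x * x)
          ⊎ (0ℤ < y × x * x < (+ D) * (y * y))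

NonNeg : ℕ → ℤ → ℤ → Set
NonNeg D x y = (x ≡ 0ℤ × y ≡ 0ℤ) ⊎ Pos D x y

InOK : ℕ → ℤ → ℤ → Set
InOK D a b with D % 4
... | 1 = (+ 2) ∣ (a - b)
... | _ = (+ 2) ∣ a × (+ 2) ∣ b

TotPos : ℕ → ℤ → ℤ → Set
TotPos D a b = Pos D a b × Pos D a (- b)

-- 4 · N((a + b √D)/2) = a² - D b²
Norm4 : ℕ → ℤ → ℤ → ℤ
Norm4 D a b = a * a - (+ D) * (b * b)

-- δ = c √D with c = 2 if D ≡ 2,3 (mod 4) and c = 1 if D ≡ 1 (mod 4)
δcoeff : ℕ → ℤ
δcoeff D with D % 4
... | 1 = + 1
... | _ = + 2

-- N(α) ≤ δ  ⇔  δ - N(α) ≥ 0  ⇔  (-(4N(α)) + 4c √D)/2 ≥ 0 (doubled coords, scaled by 4/2)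
NormLeδ : ℕ → ℤ → ℤ → Set
NormLeδ D a b = NonNeg D (- Norm4 D a b) ((+ 4) * δcoeff D)

DividesOK : ℕ → ℕ → ℤ → ℤ → Set
DividesOK D n a b = Σ ℤ λ c → Σ ℤ λ d → InOK D c d × a ≡ (+ n) * c × b ≡ (+ n) * d

SumOfTwoTotPos : ℕ → ℤ → ℤ → Set
SumOfTwoTotPos D a b =
  Σ ℤ λ a₁ → Σ ℤ λ b₁ → Σ ℤ λ a₂ → Σ ℤ λ b₂ →
    InOK D a₁ b₁ × TotPos D a₁ b₁ × InOK D a₂ b₂ × TotPos D a₂ b₂ ×
    a ≡ a₁ + a₂ × b ≡ b₁ + b₂

{-# OPTIONS --safe #-}
module Submission where

-- Write α = α₁ + α₂ with α₁, α₂ ≫ 0 and let k be the integer with α₁α₂′ − α₁′α₂ = k√D/2.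
-- If k = 0, the αᵢ are rational multiples of each other; with a, a₁ the rational parts of
-- 2α, 2α₁ and d = gcd(a, a₁) = Xa + Ya₁, the element β = Xα + Yα₁ ∈ O_K satisfies α = (a/d)β,
-- and a/d ≥ 2 because d ≤ a₁ < a.  If k ≠ 0, integrality gives 2c ∣ k (δ = c√D), and
-- N(α) = N(α₁) + N(α₂) + Tr(α₁α₂′) > Tr(α₁α₂′) > 0 with
-- Tr(α₁α₂′)² = 4N(α₁)N(α₂) + Dk²/4 ≥ c²D = δ², so N(α) > δ.

open import Defs
open import Data.Nat as ℕ using (ℕ; z≤n; s≤s)
import Data.Nat.Properties as ℕ
import Data.Nat.Divisibility as ℕ
open import Data.Nat.DivMod using (_%_)
open import Data.Nat.GCD using (gcd; gcd[m,n]∣m; gcd[m,n]∣n; gcd[m,n]≢0; gcd-GCD; module Bézout)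
open import Data.Integer as ℤ using (ℤ; +_; -[1+_]; 0ℤ; _+_; _-_; _*_; -_; ∣_∣; +<+; +≤+)
import Data.Integer.Properties as ℤ
open import Data.Integer.Divisibility.Signed
  using (_∣_; divides; ∣ᵤ⇒∣; ∣⇒∣ᵤ; ∣m∣n⇒∣m+n; ∣m∣n⇒∣m-n; ∣n⇒∣m*n; ∣m⇒∣m*n; *-monoʳ-∣)
open import Data.Integer.Tactic.RingSolver using (solve-∀)
open import Data.Product using (Σ; _×_; _,_; proj₁; proj₂)
open import Data.Sum using (inj₁; inj₂)
open import Function.Bundles using (_⇔_; mk⇔; module Equivalence)
open import Relation.Nullary using (¬_; yes; no; contradiction)
open import Relation.Binary.PropositionalEquality

open Equivalence using (to; from)

module _ where
  open import Data.Integer using (_<_; _≤_)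

  i*i≡+∣i∣*∣i∣ : ∀ i → i * i ≡ + (∣ i ∣ ℕ.* ∣ i ∣)
  i*i≡+∣i∣*∣i∣ (+ n)    = sym (ℤ.pos-* n n)
  i*i≡+∣i∣*∣i∣ -[1+ n ] = refl

  0≤i*i : ∀ i → 0ℤ ≤ i * i
  0≤i*i i rewrite i*i≡+∣i∣*∣i∣ i = +≤+ z≤n

  0<i⇒0<j⇒0<i*j : ∀ {i j} → 0ℤ < i → 0ℤ < j → 0ℤ < i * j
  0<i⇒0<j⇒0<i*j {+ m} {+ n} (+<+ 0<m) (+<+ 0<n) =
    subst (0ℤ <_) (ℤ.pos-* m n) (+<+ (ℕ.*-mono-< 0<m 0<n))

  0≤i⇒0≤j⇒0≤i*j : ∀ {i j} → 0ℤ ≤ i → 0ℤ ≤ j → 0ℤ ≤ i * j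
  0≤i⇒0≤j⇒0≤i*j {+ m} {+ n} _ _ = subst (0ℤ ≤_) (ℤ.pos-* m n) (+≤+ z≤n)

  0<i*j⇒0<i+j⇒0<i : ∀ {i j} → 0ℤ < i * j → 0ℤ < i + j → 0ℤ < i
  0<i*j⇒0<i+j⇒0<i {ℤ.+[1+ m ]}             _  _  = +<+ (s≤s z≤n)
  0<i*j⇒0<i+j⇒0<i {+ 0}                    (+<+ ()) _
  0<i*j⇒0<i+j⇒0<i { -[1+ m ]} {+ 0}        _  ()
  0<i*j⇒0<i+j⇒0<i { -[1+ m ]} { -[1+ n ]}  _  ()
  0<i*j⇒0<i+j⇒0<i { -[1+ m ]} {ℤ.+[1+ n ]} () _

  i<j⇒0<j-i : ∀ {i j} → i < j → 0ℤ < j - i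
  i<j⇒0<j-i {i} {j} i<j = subst (_< j - i) (ℤ.+-inverseʳ i) (ℤ.+-monoˡ-< (- i) i<j)

  0<i⇒j<i+j : ∀ {i j} → 0ℤ < i → j < i + j
  0<i⇒j<i+j {i} {j} 0<i = subst (_< i + j) (ℤ.+-identityˡ j) (ℤ.+-monoˡ-< j 0<i)

  0≤i⇒i<j⇒i*i<j*j : ∀ {i j} → 0ℤ ≤ i → i < j → i * i < j * j
  0≤i⇒i<j⇒i*i<j*j {+ m} {+ n} _ (+<+ m<n) =
    subst₂ _<_ (ℤ.pos-* m m) (ℤ.pos-* n n) (+<+ (ℕ.*-mono-< m<n m<n))

  i∣j⇒j≢0⇒i*i≤j*j : ∀ {i j} → i ∣ j → j ≢ 0ℤ → i * i ≤ j * j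
  i∣j⇒j≢0⇒i*i≤j*j {i} {j} i∣j j≢0 rewrite i*i≡+∣i∣*∣i∣ i | i*i≡+∣i∣*∣i∣ j =
    +≤+ (ℕ.*-mono-≤ ∣i∣≤∣j∣ ∣i∣≤∣j∣)
    where
    instance
      ∣j∣≢0 : ℕ.NonZero ∣ j ∣
      ∣j∣≢0 = ℕ.≢-nonZero (λ ∣j∣≡0 → j≢0 (ℤ.∣i∣≡0⇒i≡0 ∣j∣≡0))
    ∣i∣≤∣j∣ : ∣ i ∣ ℕ.≤ ∣ j ∣
    ∣i∣≤∣j∣ = ℕ.∣⇒≤ (∣⇒∣ᵤ i∣j)

  ∣-linear : ∀ {k x y} X Y → k ∣ x → k ∣ y → k ∣ X * x + Y * y
  ∣-linear X Y k∣x k∣y = ∣m∣n⇒∣m+n (∣n⇒∣m*n X k∣x) (∣n⇒∣m*n Y k∣y)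

  ∣-*-∣ : ∀ {i j x y} → i ∣ x → j ∣ y → i * j ∣ x * y
  ∣-*-∣ {i} {j} (divides p refl) (divides q refl) = divides (p * q) (reorder p i q j)
    where
    reorder : ∀ p i q j → (p * i) * (q * j) ≡ (p * q) * (i * j)
    reorder = solve-∀

  InOK⇔-≡1 : ∀ D a b → D % 4 ≡ 1 → InOK D a b ⇔ (+ 2 ∣ a - b)
  InOK⇔-≡1 D _ _ e with D % 4 | e
  ... | .1 | refl = mk⇔ ∣ᵤ⇒∣ ∣⇒∣ᵤ

  InOK⇔-≢1 : ∀ D a b → D % 4 ≢ 1 → InOK D a b ⇔ ((+ 2 ∣ a) × (+ 2 ∣ b))
  InOK⇔-≢1 D _ _ e with D % 4
  ... | 0                 = mk⇔ (λ (p , q) → ∣ᵤ⇒∣ p , ∣ᵤ⇒∣ q) (λ (p , q) → ∣⇒∣ᵤ p , ∣⇒∣ᵤ q)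
  ... | 1                 = contradiction refl e
  ... | ℕ.suc (ℕ.suc _)   = mk⇔ (λ (p , q) → ∣ᵤ⇒∣ p , ∣ᵤ⇒∣ q) (λ (p , q) → ∣⇒∣ᵤ p , ∣⇒∣ᵤ q)

  δcoeff-≡1 : ∀ D → D % 4 ≡ 1 → δcoeff D ≡ + 1
  δcoeff-≡1 D e with D % 4 | e
  ... | .1 | refl = refl

  δcoeff-≢1 : ∀ D → D % 4 ≢ 1 → δcoeff D ≡ + 2
  δcoeff-≢1 D e with D % 4
  ... | 0               = refl
  ... | 1               = contradiction refl e
  ... | ℕ.suc (ℕ.suc _) = refl

  InOK-linear : ∀ D {a b a′ b′} X Y → InOK D a b → InOK D a′ b′ →
                InOK D (X * a + Y * a′) (X * b + Y * b′)
  InOK-linear D {a} {b} {a′} {b′} X Y α∈O α′∈O with D % 4 ℕ.≟ 1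
  ... | yes e =
    let 2∣a-b   = to (InOK⇔-≡1 D a b e) α∈O
        2∣a′-b′ = to (InOK⇔-≡1 D a′ b′ e) α′∈O
    in from (InOK⇔-≡1 D _ _ e)
         (subst (+ 2 ∣_) (sym (diff-linear X Y a b a′ b′)) (∣-linear X Y 2∣a-b 2∣a′-b′))
    where
    diff-linear : ∀ X Y a b a′ b′ → (X * a + Y * a′) - (X * b + Y * b′) ≡ X * (a - b) + Y * (a′ - b′)
    diff-linear = solve-∀
  ... | no e =
    let 2∣a , 2∣b   = to (InOK⇔-≢1 D a b e) α∈O
        2∣a′ , 2∣b′ = to (InOK⇔-≢1 D a′ b′ e) α′∈O
    in from (InOK⇔-≢1 D _ _ e) (∣-linear X Y 2∣a 2∣a′ , ∣-linear X Y 2∣b 2∣b′)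

  -- α₁α₂′ − α₁′α₂ = cross a₁ b₁ a₂ b₂ · √D / 2
  cross : ℤ → ℤ → ℤ → ℤ → ℤ
  cross a₁ b₁ a₂ b₂ = a₂ * b₁ - a₁ * b₂

  -- 4 · Tr(α₁α₂′), matching Norm4 = 4 · N
  Trace4 : ℕ → ℤ → ℤ → ℤ → ℤ → ℤ
  Trace4 D a₁ b₁ a₂ b₂ = + 2 * (a₁ * a₂ - + D * (b₁ * b₂))

  2δcoeff∣cross : ∀ D {a₁ b₁ a₂ b₂} → InOK D a₁ b₁ → InOK D a₂ b₂ → + 2 * δcoeff D ∣ cross a₁ b₁ a₂ b₂
  2δcoeff∣cross D {a₁} {b₁} {a₂} {b₂} α₁∈O α₂∈O with D % 4 ℕ.≟ 1
  ... | yes e =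
    let 2∣a₁-b₁ = to (InOK⇔-≡1 D a₁ b₁ e) α₁∈O
        2∣a₂-b₂ = to (InOK⇔-≡1 D a₂ b₂ e) α₂∈O
    in subst₂ (λ c k → + 2 * c ∣ k) (sym (δcoeff-≡1 D e)) (sym (cross-via-differences a₁ b₁ a₂ b₂))
         (∣m∣n⇒∣m-n (∣m⇒∣m*n b₁ 2∣a₂-b₂) (∣m⇒∣m*n b₂ 2∣a₁-b₁))
    where
    cross-via-differences : ∀ a₁ b₁ a₂ b₂ → a₂ * b₁ - a₁ * b₂ ≡ (a₂ - b₂) * b₁ - (a₁ - b₁) * b₂
    cross-via-differences = solve-∀
  ... | no e =
    let 2∣a₁ , 2∣b₁ = to (InOK⇔-≢1 D a₁ b₁ e) α₁∈O
        2∣a₂ , 2∣b₂ = to (InOK⇔-≢1 D a₂ b₂ e) α₂∈O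
    in subst (λ c → + 2 * c ∣ _) (sym (δcoeff-≢1 D e))
         (∣m∣n⇒∣m-n (∣-*-∣ 2∣a₂ 2∣b₁) (∣-*-∣ 2∣a₁ 2∣b₂))

  Norm4-+ : ∀ D a₁ b₁ a₂ b₂ →
            Norm4 D (a₁ + a₂) (b₁ + b₂) ≡ (Norm4 D a₁ b₁ + Norm4 D a₂ b₂) + Trace4 D a₁ b₁ a₂ b₂
  Norm4-+ D = identity (+ D)
    where
    identity : ∀ d a₁ b₁ a₂ b₂ →
      (a₁ + a₂) * (a₁ + a₂) - d * ((b₁ + b₂) * (b₁ + b₂))
        ≡ ((a₁ * a₁ - d * (b₁ * b₁)) + (a₂ * a₂ - d * (b₂ * b₂))) + + 2 * (a₁ * a₂ - d * (b₁ * b₂))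
    identity = solve-∀

  -- Tr(x)² = 4 N(x) + (x − x′)² for x = α₁α₂′, together with N(x) = N(α₁) N(α₂)
  Trace4² : ∀ D a₁ b₁ a₂ b₂ →
            Trace4 D a₁ b₁ a₂ b₂ * Trace4 D a₁ b₁ a₂ b₂
              ≡ + 4 * (Norm4 D a₁ b₁ * Norm4 D a₂ b₂)
                + + D * ((+ 2 * cross a₁ b₁ a₂ b₂) * (+ 2 * cross a₁ b₁ a₂ b₂))
  Trace4² D = identity (+ D)
    where
    identity : ∀ d a₁ b₁ a₂ b₂ →
      (+ 2 * (a₁ * a₂ - d * (b₁ * b₂))) * (+ 2 * (a₁ * a₂ - d * (b₁ * b₂)))
        ≡ + 4 * ((a₁ * a₁ - d * (b₁ * b₁)) * (a₂ * a₂ - d * (b₂ * b₂)))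
          + d * ((+ 2 * (a₂ * b₁ - a₁ * b₂)) * (+ 2 * (a₂ * b₁ - a₁ * b₂)))
    identity = solve-∀

  TotPos⇒0<a×Db²<a² : ∀ D a b → TotPos D a b → 0ℤ < a × + D * (b * b) < a * a
  TotPos⇒0<a×Db²<a² _ _ _ (inj₁ p , _) = p
  TotPos⇒0<a×Db²<a² D a b (inj₂ (_ , a²<Db²) , inj₁ (_ , D[-b]²<a²)) =
    contradiction (subst (λ t → + D * t < a * a) (neg-square b) D[-b]²<a²) (ℤ.<-asym a²<Db²)
    where
    neg-square : ∀ b → (- b) * (- b) ≡ b * b
    neg-square = solve-∀
  TotPos⇒0<a×Db²<a² _ _ _ (inj₂ (0<b , _) , inj₂ (0<-b , _)) =
    contradiction (subst (_< 0ℤ) (ℤ.neg-involutive _) (ℤ.neg-mono-< 0<-b)) (ℤ.<-asym 0<b)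

  TotPos⇒0<a : ∀ D a b → TotPos D a b → 0ℤ < a
  TotPos⇒0<a D a b α≫0 = proj₁ (TotPos⇒0<a×Db²<a² D a b α≫0)

  TotPos⇒0<Norm4 : ∀ D a b → TotPos D a b → 0ℤ < Norm4 D a b
  TotPos⇒0<Norm4 D a b α≫0 = i<j⇒0<j-i (proj₂ (TotPos⇒0<a×Db²<a² D a b α≫0))

  0<Trace4 : ∀ D {a₁ b₁ a₂ b₂} → TotPos D a₁ b₁ → TotPos D a₂ b₂ → 0ℤ < Trace4 D a₁ b₁ a₂ b₂
  0<Trace4 D {a₁} {b₁} {a₂} {b₂} α₁≫0 α₂≫0 = 0<i⇒0<j⇒0<i*j {+ 2} (+<+ (s≤s z≤n)) 0<P
    where
    d = + D
    product : ∀ d a₁ b₁ a₂ b₂ → (a₁ * a₂ - d * (b₁ * b₂)) * (a₁ * a₂ + d * (b₁ * b₂))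
      ≡ (a₁ * a₁ - d * (b₁ * b₁)) * (a₂ * a₂) + (d * (b₁ * b₁)) * (a₂ * a₂ - d * (b₂ * b₂))
    product = solve-∀
    sum : ∀ d a₁ b₁ a₂ b₂ → (a₁ * a₂ - d * (b₁ * b₂)) + (a₁ * a₂ + d * (b₁ * b₂)) ≡ + 2 * (a₁ * a₂)
    sum = solve-∀
    P = a₁ * a₂ - d * (b₁ * b₂)
    Q = a₁ * a₂ + d * (b₁ * b₂)
    N₁ = Norm4 D a₁ b₁
    N₂ = Norm4 D a₂ b₂
    0<a₂ = TotPos⇒0<a D a₂ b₂ α₂≫0
    0<N₁a₂² : 0ℤ < N₁ * (a₂ * a₂)
    0<N₁a₂² = 0<i⇒0<j⇒0<i*j (TotPos⇒0<Norm4 D a₁ b₁ α₁≫0) (0<i⇒0<j⇒0<i*j 0<a₂ 0<a₂)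
    0≤Db₁²N₂ : 0ℤ ≤ (d * (b₁ * b₁)) * N₂
    0≤Db₁²N₂ = 0≤i⇒0≤j⇒0≤i*j (0≤i⇒0≤j⇒0≤i*j {d} (+≤+ z≤n) (0≤i*i b₁))
                             (ℤ.<⇒≤ (TotPos⇒0<Norm4 D a₂ b₂ α₂≫0))
    0<PQ : 0ℤ < P * Q
    0<PQ = subst (0ℤ <_) (sym (product d a₁ b₁ a₂ b₂)) (ℤ.+-mono-<-≤ 0<N₁a₂² 0≤Db₁²N₂)
    0<P+Q : 0ℤ < P + Q
    0<P+Q = subst (0ℤ <_) (sym (sum d a₁ b₁ a₂ b₂))
              (0<i⇒0<j⇒0<i*j {+ 2} (+<+ (s≤s z≤n)) (0<i⇒0<j⇒0<i*j (TotPos⇒0<a D a₁ b₁ α₁≫0) 0<a₂))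
    0<P : 0ℤ < P
    0<P = 0<i*j⇒0<i+j⇒0<i {P} {Q} 0<PQ 0<P+Q

  NormLeδ⇒Norm4²< : ∀ D a b → 0ℤ < Norm4 D a b → NormLeδ D a b →
                    Norm4 D a b * Norm4 D a b < + D * ((+ 4 * δcoeff D) * (+ 4 * δcoeff D))
  NormLeδ⇒Norm4²< D a b 0<M = λ
    { (inj₁ (-M≡0 , _))          → contradiction (sym (trans (sym (ℤ.neg-involutive M)) (cong -_ -M≡0))) (ℤ.<⇒≢ 0<M)
    ; (inj₂ (inj₁ (0<-M , _)))   → contradiction (ℤ.neg-mono-< 0<M) (ℤ.<-asym 0<-M)
    ; (inj₂ (inj₂ (_ , [-M]²<))) → subst (_< _) (neg-square M) [-M]²<
    }
    where
    M = Norm4 D a b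
    neg-square : ∀ x → (- x) * (- x) ≡ x * x
    neg-square = solve-∀

  cross≢0⇒¬NormLeδ : ∀ D {a₁ b₁ a₂ b₂} →
    InOK D a₁ b₁ → TotPos D a₁ b₁ → InOK D a₂ b₂ → TotPos D a₂ b₂ →
    cross a₁ b₁ a₂ b₂ ≢ 0ℤ → ¬ NormLeδ D (a₁ + a₂) (b₁ + b₂)
  cross≢0⇒¬NormLeδ D {a₁} {b₁} {a₂} {b₂} α₁∈O α₁≫0 α₂∈O α₂≫0 k≢0 N≤δ = ℤ.<-irrefl refl (begin-strict
    + D * (4c * 4c)                    ≤⟨ ℤ.*-monoˡ-≤-nonNeg (+ D) (i∣j⇒j≢0⇒i*i≤j*j 4c∣2k 2k≢0) ⟩
    + D * (2k * 2k)                    ≤⟨ ℤ.i≤j+i _ _ ⦃ ℤ.nonNegative 0≤4N₁N₂ ⦄ ⟩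
    + 4 * (N₁ * N₂) + + D * (2k * 2k)  ≡⟨ Trace4² D a₁ b₁ a₂ b₂ ⟨
    T * T                              <⟨ 0≤i⇒i<j⇒i*i<j*j (ℤ.<⇒≤ 0<T) T<M ⟩
    M * M                              <⟨ NormLeδ⇒Norm4²< D (a₁ + a₂) (b₁ + b₂) (ℤ.<-trans 0<T T<M) N≤δ ⟩
    + D * (4c * 4c)                    ∎)
    where
    open ℤ.≤-Reasoning
    k  = cross a₁ b₁ a₂ b₂
    2k = + 2 * k
    4c = + 4 * δcoeff D
    N₁ = Norm4 D a₁ b₁
    N₂ = Norm4 D a₂ b₂
    T  = Trace4 D a₁ b₁ a₂ b₂
    M  = Norm4 D (a₁ + a₂) (b₁ + b₂)
    0<N₁ = TotPos⇒0<Norm4 D a₁ b₁ α₁≫0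
    0<N₂ = TotPos⇒0<Norm4 D a₂ b₂ α₂≫0
    0<T : 0ℤ < T
    0<T = 0<Trace4 D α₁≫0 α₂≫0
    T<M : T < M
    T<M = subst (T <_) (sym (Norm4-+ D a₁ b₁ a₂ b₂))
            (0<i⇒j<i+j {N₁ + N₂} (ℤ.+-mono-< 0<N₁ 0<N₂))
    0≤4N₁N₂ : 0ℤ ≤ + 4 * (N₁ * N₂)
    0≤4N₁N₂ = 0≤i⇒0≤j⇒0≤i*j {+ 4} (+≤+ z≤n)
                (ℤ.<⇒≤ (0<i⇒0<j⇒0<i*j 0<N₁ 0<N₂))
    4c∣2k : 4c ∣ 2k
    4c∣2k = subst (_∣ 2k) (sym (ℤ.*-assoc (+ 2) (+ 2) (δcoeff D)))
              (*-monoʳ-∣ (+ 2) (2δcoeff∣cross D α₁∈O α₂∈O))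
    2k≢0 : 2k ≢ 0ℤ
    2k≢0 2k≡0 = k≢0 (ℤ.*-cancelˡ-≡ (+ 2) k 0ℤ (trans 2k≡0 (sym (ℤ.*-zeroʳ (+ 2)))))

  +-cast : ∀ d y n x m → d ℕ.+ y ℕ.* n ≡ x ℕ.* m → + d + + y * + n ≡ + x * + m
  +-cast d y n x m eq =
    trans (cong (_+_ (+ d)) (sym (ℤ.pos-* y n))) (trans (cong +_ eq) (ℤ.pos-* x m))

  bézout-ℤ : ∀ {d m n} → Bézout.Identity d m n → Σ ℤ λ X → Σ ℤ λ Y → + d ≡ X * + m + Y * + n
  bézout-ℤ {d} {m} {n} (Bézout.+- x y eq) =
    + x , - + y , trans (move (+ d) (+ y) (+ n)) (cong (_+ (- + y) * + n) (+-cast d y n x m eq))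
    where
    move : ∀ d y n → d ≡ (d + y * n) + (- y) * n
    move = solve-∀
  bézout-ℤ {d} {m} {n} (Bézout.-+ x y eq) =
    - + x , + y , trans (move (+ d) (+ x) (+ m)) (cong (_+_ ((- + x) * + m)) (+-cast d x m y n eq))
    where
    move : ∀ d x m → d ≡ (- x) * m + (d + x * m)
    move = solve-∀

  combination-divides : ∀ D {a b a₁ b₁ X Y : ℤ} {d q : ℕ} .{{_ : ℕ.NonZero d}} →
    InOK D a b → InOK D a₁ b₁ → a₁ * b ≡ a * b₁ →
    + d ≡ X * a + Y * a₁ → a ≡ + q * + d → DividesOK D q a b
  combination-divides D {a} {b} {a₁} {b₁} {X} {Y} {d} {q} α∈O α₁∈O a₁b≡ab₁ d≡Xa+Ya₁ a≡qd =
    + d , e , subst (λ t → InOK D t e) (sym d≡Xa+Ya₁) (InOK-linear D X Y α∈O α₁∈O) , a≡qd , b≡qe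
    where
    open ≡-Reasoning
    e = X * b + Y * b₁
    expand : ∀ X Y a a₁ b → (X * a + Y * a₁) * b ≡ X * (a * b) + Y * (a₁ * b)
    expand = solve-∀
    collect : ∀ X Y a b b₁ → X * (a * b) + Y * (a * b₁) ≡ a * (X * b + Y * b₁)
    collect = solve-∀
    regroup : ∀ q d e → (q * d) * e ≡ d * (q * e)
    regroup = solve-∀
    db≡dqe : + d * b ≡ + d * (+ q * e)
    db≡dqe = begin
      + d * b                     ≡⟨ cong (_* b) d≡Xa+Ya₁ ⟩
      (X * a + Y * a₁) * b        ≡⟨ expand X Y a a₁ b ⟩
      X * (a * b) + Y * (a₁ * b)  ≡⟨ cong (λ t → X * (a * b) + Y * t) a₁b≡ab₁ ⟩
      X * (a * b) + Y * (a * b₁)  ≡⟨ collect X Y a b b₁ ⟩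
      a * e                       ≡⟨ cong (_* e) a≡qd ⟩
      (+ q * + d) * e             ≡⟨ regroup (+ q) (+ d) e ⟩
      + d * (+ q * e)             ∎
    b≡qe : b ≡ + q * e
    b≡qe = ℤ.*-cancelˡ-≡ (+ d) b (+ q * e) db≡dqe

  cross≡0⇒proportional : ∀ a₁ b₁ a₂ b₂ → cross a₁ b₁ a₂ b₂ ≡ 0ℤ → a₁ * (b₁ + b₂) ≡ (a₁ + a₂) * b₁
  cross≡0⇒proportional a₁ b₁ a₂ b₂ k≡0 = begin
    a₁ * (b₁ + b₂)                        ≡⟨ via-cross a₁ b₁ a₂ b₂ ⟩
    (a₁ + a₂) * b₁ - cross a₁ b₁ a₂ b₂    ≡⟨ cong (_-_ ((a₁ + a₂) * b₁)) k≡0 ⟩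
    (a₁ + a₂) * b₁ - 0ℤ                   ≡⟨ ℤ.+-identityʳ _ ⟩
    (a₁ + a₂) * b₁                        ∎
    where
    open ≡-Reasoning
    via-cross : ∀ a₁ b₁ a₂ b₂ → a₁ * (b₁ + b₂) ≡ (a₁ + a₂) * b₁ - (a₂ * b₁ - a₁ * b₂)
    via-cross = solve-∀

  d∣n∧n<q*d⇒2≤q : ∀ {d n q} .{{_ : ℕ.NonZero n}} → d ℕ.∣ n → n ℕ.< q ℕ.* d → 2 ℕ.≤ q
  d∣n∧n<q*d⇒2≤q {q = 0}                   _   ()
  d∣n∧n<q*d⇒2≤q {d} {q = 1}               d∣n n<d =
    contradiction (subst (_ ℕ.<_) (ℕ.+-identityʳ d) n<d) (ℕ.≤⇒≯ (ℕ.∣⇒≤ d∣n))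
  d∣n∧n<q*d⇒2≤q {q = ℕ.suc (ℕ.suc _)}     _   _   = s≤s (s≤s z≤n)

  proportional-sum-divisible : ∀ D {a₁ b₁ a₂ b₂} → InOK D (a₁ + a₂) (b₁ + b₂) → InOK D a₁ b₁ →
    0ℤ < a₁ → 0ℤ < a₂ → cross a₁ b₁ a₂ b₂ ≡ 0ℤ →
    Σ ℕ λ n → 2 ℕ.≤ n × DividesOK D n (a₁ + a₂) (b₁ + b₂)
  proportional-sum-divisible D {+ A₁} {b₁} {+ A₂} {b₂} α∈O α₁∈O (+<+ 0<A₁) (+<+ 0<A₂) k≡0 =
    q , d∣n∧n<q*d⇒2≤q (gcd[m,n]∣n A A₁) (subst (A₁ ℕ.<_) A≡qd (ℕ.m<m+n A₁ 0<A₂)) ,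
    combination-divides D {X = X} {Y = Y} {q = q} α∈O α₁∈O
      (cross≡0⇒proportional (+ A₁) b₁ (+ A₂) b₂ k≡0) d≡XA+YA₁ (trans (cong +_ A≡qd) (ℤ.pos-* q d))
    where
    A = A₁ ℕ.+ A₂
    d = gcd A A₁
    instance
      A₁≢0 : ℕ.NonZero A₁
      A₁≢0 = ℕ.>-nonZero 0<A₁
      d≢0 : ℕ.NonZero d
      d≢0 = ℕ.≢-nonZero (gcd[m,n]≢0 A A₁ (inj₂ (ℕ.≢-nonZero⁻¹ A₁)))
    q = ℕ._∣_.quotient (gcd[m,n]∣m A A₁)
    A≡qd : A ≡ q ℕ.* d
    A≡qd = ℕ._∣_.equality (gcd[m,n]∣m A A₁)
    bézout = bézout-ℤ (Bézout.identity (gcd-GCD A A₁))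
    X = proj₁ bézout
    Y = proj₁ (proj₂ bézout)
    d≡XA+YA₁ : + d ≡ X * + A + Y * + A₁
    d≡XA+YA₁ = proj₂ (proj₂ bézout)

open import Data.Nat using (_<_; _≤_)

lemma2p3 : (D : ℕ) → 1 < D → SquareFree D →
    (a b : ℤ) → InOK D a b → TotPos D a b → NormLeδ D a b →
    ((n : ℕ) → 2 ≤ n → ¬ DividesOK D n a b) →
    ¬ SumOfTwoTotPos D a b
lemma2p3 D _ _ .(a₁ + a₂) .(b₁ + b₂) α∈O _ N≤δ indivisible
    (a₁ , b₁ , a₂ , b₂ , α₁∈O , α₁≫0 , α₂∈O , α₂≫0 , refl , refl)
  with cross a₁ b₁ a₂ b₂ ℤ.≟ 0ℤ
... | yes k≡0 =
  let n , 2≤n , n∣α = proportional-sum-divisible D α∈O α₁∈O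
                        (TotPos⇒0<a D a₁ b₁ α₁≫0) (TotPos⇒0<a D a₂ b₂ α₂≫0) k≡0
  in indivisible n 2≤n n∣α
... | no k≢0 = cross≢0⇒¬NormLeδ D α₁∈O α₁≫0 α₂∈O α₂≫0 k≢0 N≤δ
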